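{- Let $R$ be an integral domain of characteristic zero, let $n$ be a positive integer, and let $M=(m_{i,j})\in \operatorname{Frac}(R)^{n\times n}$ be a frieze matrix. Writing $x_i=m_{i,i+1}$ for $1\le i\le n-1$, we have \[ \det(M) = -(-2)^{n-2}\, m_{1,n}\prod_{i=1}^{n-1} x_i . \]
   Context: A frieze matrix is a symmetric matrix $M=(m_{i,j})\in \operatorname{Frac}(R)^{n\times n}$ (with $\operatorname{Frac}(R)$ the field of fractions of $R$) such that $m_{i,j}=0$ if and only if $i=j$, and whose entries satisfy the generalized diamond rule \[ m_{i,j}m_{i+1,j+1}-m_{i+1,j}m_{i,j+1}=m_{i,i+1}m_{j,j+1} \] for all indices $1\le i$ and $j\ge i+1$ with $j+1\le n$. -}

module Defs where

open import Level using (Level)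
open import Algebra.Bundles using (CommutativeRing)
open import Data.Nat using (ℕ; zero; suc; _<_)
open import Data.Fin using (Fin; zero; suc; toℕ; punchIn; inject₁; fromℕ)
open import Data.Product using (Σ; _,_; proj₁; proj₂)
open import Data.Sum using (_⊎_; [_,_])
open import Relation.Nullary using (¬_)
open import Relation.Binary.PropositionalEquality using (_≡_)

module RawOps {a} {A : Set a} (_+_ _*_ : A → A → A) (-_ : A → A) (0# 1# : A) where

  sumFin : ∀ n → (Fin n → A) → A
  sumFin zero    f = 0#
  sumFin (suc n) f = f zero + sumFin n (λ i → f (suc i))

  prodFin : ∀ n → (Fin n → A) → A
  prodFin zero    f = 1#
  prodFin (suc n) f = f zero * prodFin n (λ i → f (suc i))

  negPow : ℕ → A → A
  negPow zero    x = x
  negPow (suc k) x = - (negPow k x)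

  det : ∀ n → (Fin n → Fin n → A) → A
  det zero    M = 1#
  det (suc n) M =
    sumFin (suc n) (λ j →
      negPow (toℕ j) (M zero j * det n (λ r c → M (suc r) (punchIn j c))))

module RingNat {c ℓ} (R : CommutativeRing c ℓ) where
  open CommutativeRing R using (Carrier; _≈_; _+_; _*_; -_; 0#; 1#)

  fromℕR : ℕ → Carrier
  fromℕR zero    = 0#
  fromℕR (suc k) = 1# + fromℕR k

IsNontrivial : ∀ {c ℓ} → CommutativeRing c ℓ → Set ℓ
IsNontrivial R = ¬ (1# ≈ 0#) where open CommutativeRing R using (Carrier; _≈_; _+_; _*_; -_; 0#; 1#)

NoZeroDivisors : ∀ {c ℓ} → CommutativeRing c ℓ → Set _
NoZeroDivisors R = ∀ x y → x * y ≈ 0# → (x ≈ 0#) ⊎ (y ≈ 0#)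
  where open CommutativeRing R using (Carrier; _≈_; _+_; _*_; -_; 0#; 1#)

CharZero : ∀ {c ℓ} → CommutativeRing c ℓ → Set ℓ
CharZero R = ∀ k → ¬ (fromℕR (suc k) ≈ 0#)
  where open CommutativeRing R using (Carrier; _≈_; _+_; _*_; -_; 0#; 1#)
        open RingNat R

-- Field of fractions Frac(R) of an integral domain R, as a setoid of
-- pairs (numerator, nonzero denominator), with (a,b) ≈ (c,d) iff ad = cb.

module Frac {c ℓ} (R : CommutativeRing c ℓ)
            (nt : IsNontrivial R) (nzd : NoZeroDivisors R) where
  open CommutativeRing R using (Carrier; _≈_; _+_; _*_; -_; 0#; 1#)

  F : Set _
  F = Σ Carrier (λ _ → Σ Carrier (λ b → ¬ (b ≈ 0#)))

  num : F → Carrier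
  num = proj₁

  den : F → Carrier
  den q = proj₁ (proj₂ q)

  den≉0 : (q : F) → ¬ (den q ≈ 0#)
  den≉0 q = proj₂ (proj₂ q)

  private
    nz* : ∀ {b d} → ¬ (b ≈ 0#) → ¬ (d ≈ 0#) → ¬ (b * d ≈ 0#)
    nz* {b} {d} bn dn e = [ bn , dn ] (nzd b d e)

  infix 4 _≈F_
  _≈F_ : F → F → Set ℓ
  p ≈F q = num p * den q ≈ num q * den p

  infixl 6 _+F_ _-F_
  infixl 7 _*F_

  _+F_ : F → F → F
  p +F q = (num p * den q + num q * den p) , (den p * den q) , nz* (den≉0 p) (den≉0 q)

  _*F_ : F → F → F
  p *F q = (num p * num q) , (den p * den q) , nz* (den≉0 p) (den≉0 q)

  -F_ : F → F
  -F p = (- num p) , den p , den≉0 p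

  _-F_ : F → F → F
  p -F q = p +F (-F q)

  0F : F
  0F = 0# , 1# , nt

  1F : F
  1F = 1# , 1# , nt

  open RawOps _+F_ _*F_ -F_ 0F 1F public

  -- A frieze matrix (0-based indices): symmetric, m i j = 0 iff i = j,
  -- and the generalized diamond rule
  --   m i j · m (i+1) (j+1) − m (i+1) j · m i (j+1) = m i (i+1) · m j (j+1)
  -- for all i < j with j+1 a valid index.
  record IsFriezeMatrix (n : ℕ) (M : Fin n → Fin n → F) : Set (c Level.⊔ ℓ) where
    field
      symmetric : ∀ i j → M i j ≈F M j i
      zero⇒diag : ∀ i j → M i j ≈F 0F → i ≡ j
      diag⇒zero : ∀ i → M i i ≈F 0F
      diamond   : ∀ i i′ j j′ → toℕ i′ ≡ suc (toℕ i) → toℕ j′ ≡ suc (toℕ j) →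
                  toℕ i < toℕ j →
                  (M i j *F M i′ j′) -F (M i′ j *F M i j′) ≈F M i i′ *F M j j′

module FracChar0 {c ℓ} (R : CommutativeRing c ℓ)
                 (nt : IsNontrivial R) (nzd : NoZeroDivisors R) (ch : CharZero R) where
  open CommutativeRing R using (Carrier; _≈_; _+_; _*_; -_; 0#; 1#)
  open RingNat R
  open Frac R nt nzd public

  -- (-2)^(k-1) ∈ Frac(R), where for k = 0 this is (-2)^(-1) = (-1)/2
  negTwoPowPred : ℕ → F
  negTwoPowPred zero          = (- 1#) , fromℕR 2 , ch 1
  negTwoPowPred (suc zero)    = 1F
  negTwoPowPred (suc (suc k)) = (-F ((fromℕR 2) , 1# , nt)) *F negTwoPowPred (suc k)

  -- right-hand side for an n×n matrix with n = suc k: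
  --   −(−2)^(n−2) · m_{1,n} · ∏_{i=1}^{n−1} m_{i,i+1}
  friezeDetRHS : ∀ k → (Fin (suc k) → Fin (suc k) → F) → F
  friezeDetRHS k M =
    ((-F negTwoPowPred k) *F M zero (fromℕ k))
      *F prodFin k (λ i → M (inject₁ i) (suc i))

module Submission where

-- Indices start at 0 and x i = m (i , i+1). For each k, the combination
-- x (k+1) · C k − m (k , k+2) · C (k+1) + x k · C (k+2) of three consecutive columns of M
-- vanishes in every row except row k+1, where it equals 2 x k x (k+1): directly in rows k and
-- k+2, and in the other rows because the diamond rule makes its values in two adjacent rows
-- proportional, with nonzero off-diagonal factors. Let B k be the submatrix on the rows
-- 0, k+1, …, n−1 and the columns k, …, n−1, so that B 0 = M. Replacing the first column of B k
-- by this combination multiplies its determinant by x (k+1), and expanding along the new column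
-- gives det (B k) = −2 x k · det (B (k+1)). The last one is the 2 × 2 determinant
-- −m (0 , n−1) x (n−2), which gives the formula.

open import Defs
open import Level using (Level; _⊔_; 0ℓ)
open import Algebra.Bundles using (CommutativeRing; RawRing)
open import Algebra.Structures using (IsCommutativeRing)
open import Data.Nat as ℕ using (ℕ; zero; suc; _<_; _≤_; _<?_; s≤s)
import Data.Nat.Properties as ℕ
open import Data.Fin using (Fin; zero; suc; toℕ; punchIn; fromℕ; fromℕ<; inject₁)
open import Data.Fin.Properties using (toℕ-fromℕ; toℕ-fromℕ<; fromℕ<-toℕ; toℕ<n; toℕ-inject₁)
open import Data.Vec.Functional using (tail; removeAt)
open import Data.Product using (_,_) renaming (_×_ to _⊗_)
open import Data.Sum using (inj₁; inj₂)
open import Data.Maybe using (Maybe; just; nothing)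
open import Relation.Nullary using (¬_; Dec; yes; no; contradiction)
open import Relation.Binary.Definitions using (tri<; tri≈; tri>)
open import Relation.Binary.PropositionalEquality as ≡ using (_≡_; _≢_)
import Algebra.Solver.Ring.AlmostCommutativeRing as AlmostCommutativeRing
import Algebra.Solver.Ring as RingSolver

module IntegerRingSolver {c ℓ} (R : CommutativeRing c ℓ) where
  open CommutativeRing R
  open import Algebra.Properties.Ring ring
    using (-‿+-comm; -0#≈0#; ⁻¹-anti-homo‿-; -‿distribˡ-*; -‿distribʳ-*; -‿involutive)
  open import Algebra.Properties.CommutativeSemigroup +-commutativeSemigroup using (interchange)
  open import Algebra.Properties.Semiring.Mult semiring using (_×_; ×-homo-+; ×1-homo-*)
  open import Relation.Binary.Reasoning.Setoid setoid

  -- The coefficients are the integers, a pair (a , b) standing for a − b.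
  ℤ-as-ℕ² : RawRing 0ℓ 0ℓ
  ℤ-as-ℕ² = record
    { Carrier = ℕ ⊗ ℕ
    ; _≈_ = _≡_
    ; _+_ = λ { (a , b) (c , d) → (a ℕ.+ c , b ℕ.+ d) }
    ; _*_ = λ { (a , b) (c , d) → (a ℕ.* c ℕ.+ b ℕ.* d , a ℕ.* d ℕ.+ b ℕ.* c) }
    ; -_ = λ { (a , b) → (b , a) }
    ; 0# = (0 , 0)
    ; 1# = (1 , 0)
    }

  difference : ℕ ⊗ ℕ → Carrier
  difference (a , b) = a × 1# - b × 1#

  -- Agrees with difference, but sends (0 , 0) and (1 , 0) to 0# and 1# on the
  -- nose, so that the constants 0# and 1# of a goal are recognised by the solver.
  ⟦_⟧ : ℕ ⊗ ℕ → Carrier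
  ⟦ 0 , 0 ⟧ = 0#
  ⟦ 1 , 0 ⟧ = 1#
  ⟦ p ⟧ = difference p

  ⟦⟧≈difference : ∀ p → ⟦ p ⟧ ≈ difference p
  ⟦⟧≈difference (0 , 0) = sym (-‿inverseʳ 0#)
  ⟦⟧≈difference (1 , 0) = sym (trans (+-cong (+-identityʳ 1#) -0#≈0#) (+-identityʳ 1#))
  ⟦⟧≈difference (0 , suc b) = refl
  ⟦⟧≈difference (1 , suc b) = refl
  ⟦⟧≈difference (suc (suc a) , b) = refl

  -‿+-distrib : ∀ x y → - (x + y) ≈ - x + - y
  -‿+-distrib x y = sym (-‿+-comm x y)

  [x+y]-[z+w] : ∀ x y z w → (x + y) - (z + w) ≈ (x - z) + (y - w)
  [x+y]-[z+w] x y z w = trans (+-congˡ (-‿+-distrib z w)) (interchange x y (- z) (- w))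

  [x-y][z-w] : ∀ x y z w → (x - y) * (z - w) ≈ (x * z + y * w) - (x * w + y * z)
  [x-y][z-w] x y z w = begin
    (x - y) * (z - w)                          ≈⟨ distribʳ (z - w) x (- y) ⟩
    x * (z - w) + - y * (z - w)                ≈⟨ +-cong (distribˡ x z (- w)) (distribˡ (- y) z (- w)) ⟩
    (x * z + x * - w) + (- y * z + - y * - w)  ≈⟨ +-cong (+-congˡ (sym (-‿distribʳ-* x w)))
                                                       (+-cong (sym (-‿distribˡ-* y z)) -y*-w≈yw) ⟩
    (x * z - x * w) + (- (y * z) + y * w)      ≈⟨ +-congˡ (+-comm (- (y * z)) (y * w)) ⟩
    (x * z - x * w) + (y * w - y * z)          ≈⟨ [x+y]-[z+w] (x * z) (y * w) (x * w) (y * z) ⟨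
    (x * z + y * w) - (x * w + y * z)          ∎
    where
    -y*-w≈yw : - y * - w ≈ y * w
    -y*-w≈yw = trans (sym (-‿distribˡ-* y (- w)))
                     (trans (-‿cong (sym (-‿distribʳ-* y w))) (-‿involutive (y * w)))

  x-y≈z-w : ∀ x y z w → x + w ≈ z + y → x - y ≈ z - w
  x-y≈z-w x y z w e = begin
    x - y                ≈⟨ +-identityʳ (x - y) ⟨
    (x - y) + 0#         ≈⟨ +-congˡ (-‿inverseʳ w) ⟨
    (x - y) + (w - w)    ≈⟨ [x+y]-[z+w] x w y w ⟨
    (x + w) - (y + w)    ≈⟨ +-cong e (-‿cong (+-comm y w)) ⟩
    (z + y) - (w + y)    ≈⟨ [x+y]-[z+w] z y w y ⟩
    (z - w) + (y - y)    ≈⟨ +-congˡ (-‿inverseʳ y) ⟩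
    (z - w) + 0#         ≈⟨ +-identityʳ (z - w) ⟩
    z - w                ∎

  ι-homo-+ : ∀ a b → (a ℕ.+ b) × 1# ≈ a × 1# + b × 1#
  ι-homo-+ = ×-homo-+ 1#

  difference-homomorphism :
    ℤ-as-ℕ² AlmostCommutativeRing.-Raw-AlmostCommutative⟶ AlmostCommutativeRing.fromCommutativeRing R
  difference-homomorphism = record
    { ⟦_⟧ = difference
    ; +-homo = λ { (a , b) (c , d) →
        trans (+-cong (ι-homo-+ a c) (-‿cong (ι-homo-+ b d))) ([x+y]-[z+w] (a × 1#) (c × 1#) (b × 1#) (d × 1#)) }
    ; *-homo = λ { (a , b) (c , d) →
        trans (+-cong (ι-homo-* a c b d) (-‿cong (ι-homo-* a d b c)))
              (sym ([x-y][z-w] (a × 1#) (b × 1#) (c × 1#) (d × 1#))) }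
    ; -‿homo = λ { (a , b) → sym (⁻¹-anti-homo‿- (a × 1#) (b × 1#)) }
    ; 0-homo = -‿inverseʳ 0#
    ; 1-homo = trans (+-cong (+-identityʳ 1#) -0#≈0#) (+-identityʳ 1#)
    }
    where
    ι-homo-* : ∀ a b c d → (a ℕ.* b ℕ.+ c ℕ.* d) × 1# ≈ (a × 1#) * (b × 1#) + (c × 1#) * (d × 1#)
    ι-homo-* a b c d = trans (ι-homo-+ (a ℕ.* b) (c ℕ.* d)) (+-cong (×1-homo-* a b) (×1-homo-* c d))

  ⟦⟧-homomorphism :
    ℤ-as-ℕ² AlmostCommutativeRing.-Raw-AlmostCommutative⟶ AlmostCommutativeRing.fromCommutativeRing R
  ⟦⟧-homomorphism = record
    { ⟦_⟧ = ⟦_⟧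
    ; +-homo = λ p q → transport (H.+-homo p q) (⟦⟧≈difference (p ℤ.+ q)) (+-cong (⟦⟧≈difference p) (⟦⟧≈difference q))
    ; *-homo = λ p q → transport (H.*-homo p q) (⟦⟧≈difference (p ℤ.* q)) (*-cong (⟦⟧≈difference p) (⟦⟧≈difference q))
    ; -‿homo = λ p → transport (H.-‿homo p) (⟦⟧≈difference (ℤ.- p)) (-‿cong (⟦⟧≈difference p))
    ; 0-homo = refl
    ; 1-homo = refl
    }
    where
    module H = AlmostCommutativeRing._-Raw-AlmostCommutative⟶_ difference-homomorphism
    module ℤ = RawRing ℤ-as-ℕ²
    transport : ∀ {x y x′ y′} → x′ ≈ y′ → x ≈ x′ → y ≈ y′ → x ≈ y
    transport e x≈x′ y≈y′ = trans x≈x′ (trans e (sym y≈y′))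

  ⟦⟧-≟ : ∀ p q → Maybe (⟦ p ⟧ ≈ ⟦ q ⟧)
  ⟦⟧-≟ (a , b) (c , d) with a ℕ.+ d ℕ.≟ c ℕ.+ b
  ... | no _ = nothing
  ... | yes e = just (trans (⟦⟧≈difference (a , b)) (trans (x-y≈z-w _ _ _ _ (begin
          a × 1# + d × 1#     ≈⟨ ι-homo-+ a d ⟨
          (a ℕ.+ d) × 1#      ≡⟨ ≡.cong (_× 1#) e ⟩
          (c ℕ.+ b) × 1#      ≈⟨ ι-homo-+ c b ⟩
          c × 1# + b × 1#     ∎)) (sym (⟦⟧≈difference (c , d)))))

  open RingSolver ℤ-as-ℕ² (AlmostCommutativeRing.fromCommutativeRing R) ⟦⟧-homomorphism ⟦⟧-≟ public
    using (solve; _:=_; _:+_; _:*_; :-_; _:-_; con)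

module IntegralDomain {c ℓ} (R : CommutativeRing c ℓ) (nzd : NoZeroDivisors R) where
  open CommutativeRing R
  open import Algebra.Properties.Ring ring using (x[y-z]≈xy-xz; x∙y⁻¹≈ε⇒x≈y; x≈y⇒x∙y⁻¹≈ε)

  *-cancelˡ-≈0 : ∀ a {x} → ¬ a ≈ 0# → a * x ≈ 0# → x ≈ 0#
  *-cancelˡ-≈0 a {x} a≉0 ax≈0 with nzd a x ax≈0
  ... | inj₁ a≈0 = contradiction a≈0 a≉0
  ... | inj₂ x≈0 = x≈0

  *-cancelˡ-≈ : ∀ a {x y} → ¬ a ≈ 0# → a * x ≈ a * y → x ≈ y
  *-cancelˡ-≈ a {x} {y} a≉0 ax≈ay =
    x∙y⁻¹≈ε⇒x≈y x y (*-cancelˡ-≈0 a a≉0 (trans (x[y-z]≈xy-xz a x y) (x≈y⇒x∙y⁻¹≈ε ax≈ay)))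

module FractionField {c ℓ} (R : CommutativeRing c ℓ) (nt : IsNontrivial R) (nzd : NoZeroDivisors R) where
  open CommutativeRing R
  open IntegerRingSolver R
  open IntegralDomain R nzd
  open Frac R nt nzd
  open import Relation.Binary.Reasoning.Setoid setoid

  ≈F-trans : ∀ {p q r} → p ≈F q → q ≈F r → p ≈F r
  ≈F-trans {np , dp , _} {nq , dq , dq≉0} {nr , dr , _} e₁ e₂ = *-cancelˡ-≈ dq dq≉0 (begin
    dq * (np * dr) ≈⟨ solve 3 (λ dq np dr → dq :* (np :* dr) := (np :* dq) :* dr) refl dq np dr ⟩
    (np * dq) * dr ≈⟨ *-congʳ e₁ ⟩
    (nq * dp) * dr ≈⟨ solve 3 (λ nq dp dr → (nq :* dp) :* dr := dp :* (nq :* dr)) refl nq dp dr ⟩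
    dp * (nq * dr) ≈⟨ *-congˡ e₂ ⟩
    dp * (nr * dq) ≈⟨ solve 3 (λ dp nr dq → dp :* (nr :* dq) := dq :* (nr :* dp)) refl dp nr dq ⟩
    dq * (nr * dp) ∎)

  +F-cong : ∀ {p p′ q q′} → p ≈F p′ → q ≈F q′ → p +F q ≈F p′ +F q′
  +F-cong {np , dp , _} {np′ , dp′ , _} {nq , dq , _} {nq′ , dq′ , _} e₁ e₂ = begin
    (np * dq + nq * dp) * (dp′ * dq′)
      ≈⟨ solve 6 (λ np dq nq dp dp′ dq′ → (np :* dq :+ nq :* dp) :* (dp′ :* dq′)
                   := (np :* dp′) :* (dq :* dq′) :+ (nq :* dq′) :* (dp :* dp′)) refl np dq nq dp dp′ dq′ ⟩
    (np * dp′) * (dq * dq′) + (nq * dq′) * (dp * dp′)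
      ≈⟨ +-cong (*-congʳ e₁) (*-congʳ e₂) ⟩
    (np′ * dp) * (dq * dq′) + (nq′ * dq) * (dp * dp′)
      ≈⟨ solve 6 (λ np′ dq nq′ dp dp′ dq′ → (np′ :* dp) :* (dq :* dq′) :+ (nq′ :* dq) :* (dp :* dp′)
                   := (np′ :* dq′ :+ nq′ :* dp′) :* (dp :* dq)) refl np′ dq nq′ dp dp′ dq′ ⟩
    (np′ * dq′ + nq′ * dp′) * (dp * dq) ∎

  *F-cong : ∀ {p p′ q q′} → p ≈F p′ → q ≈F q′ → p *F q ≈F p′ *F q′
  *F-cong {np , dp , _} {np′ , dp′ , _} {nq , dq , _} {nq′ , dq′ , _} e₁ e₂ = begin
    (np * nq) * (dp′ * dq′) ≈⟨ solve 4 (λ np nq dp′ dq′ → (np :* nq) :* (dp′ :* dq′) := (np :* dp′) :* (nq :* dq′)) refl np nq dp′ dq′ ⟩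
    (np * dp′) * (nq * dq′) ≈⟨ *-cong e₁ e₂ ⟩
    (np′ * dp) * (nq′ * dq) ≈⟨ solve 4 (λ np′ nq′ dp dq → (np′ :* dp) :* (nq′ :* dq) := (np′ :* nq′) :* (dp :* dq)) refl np′ nq′ dp dq ⟩
    (np′ * nq′) * (dp * dq) ∎

  -F-cong : ∀ {p p′} → p ≈F p′ → -F p ≈F -F p′
  -F-cong {np , dp , _} {np′ , dp′ , _} e = begin
    - np * dp′   ≈⟨ solve 2 (λ np dp′ → :- np :* dp′ := :- (np :* dp′)) refl np dp′ ⟩
    - (np * dp′) ≈⟨ -‿cong e ⟩
    - (np′ * dp) ≈⟨ solve 2 (λ np′ dp → :- (np′ :* dp) := :- np′ :* dp) refl np′ dp ⟩
    - np′ * dp   ∎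

  +F-assoc : ∀ p q r → (p +F q) +F r ≈F p +F (q +F r)
  +F-assoc (np , dp , _) (nq , dq , _) (nr , dr , _) =
    solve 6 (λ np dp nq dq nr dr → ((np :* dq :+ nq :* dp) :* dr :+ nr :* (dp :* dq)) :* (dp :* (dq :* dr))
                                    := (np :* (dq :* dr) :+ (nq :* dr :+ nr :* dq) :* dp) :* ((dp :* dq) :* dr))
            refl np dp nq dq nr dr

  +F-comm : ∀ p q → p +F q ≈F q +F p
  +F-comm (np , dp , _) (nq , dq , _) =
    solve 4 (λ np dp nq dq → (np :* dq :+ nq :* dp) :* (dq :* dp) := (nq :* dp :+ np :* dq) :* (dp :* dq))
            refl np dp nq dq

  +F-identityˡ : ∀ p → 0F +F p ≈F p
  +F-identityˡ (np , dp , _) =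
    solve 2 (λ np dp → (con (0 , 0) :* dp :+ np :* con (1 , 0)) :* dp := np :* (con (1 , 0) :* dp)) refl np dp

  +F-identityʳ : ∀ p → p +F 0F ≈F p
  +F-identityʳ (np , dp , _) =
    solve 2 (λ np dp → (np :* con (1 , 0) :+ con (0 , 0) :* dp) :* dp := np :* (dp :* con (1 , 0))) refl np dp

  -F-inverseˡ : ∀ p → (-F p) +F p ≈F 0F
  -F-inverseˡ (np , dp , _) =
    solve 2 (λ np dp → (:- np :* dp :+ np :* dp) :* con (1 , 0) := con (0 , 0) :* (dp :* dp)) refl np dp

  -F-inverseʳ : ∀ p → p +F (-F p) ≈F 0F
  -F-inverseʳ (np , dp , _) =
    solve 2 (λ np dp → (np :* dp :+ :- np :* dp) :* con (1 , 0) := con (0 , 0) :* (dp :* dp)) refl np dp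

  *F-assoc : ∀ p q r → (p *F q) *F r ≈F p *F (q *F r)
  *F-assoc (np , dp , _) (nq , dq , _) (nr , dr , _) =
    solve 6 (λ np dp nq dq nr dr → ((np :* nq) :* nr) :* (dp :* (dq :* dr)) := (np :* (nq :* nr)) :* ((dp :* dq) :* dr))
            refl np dp nq dq nr dr

  *F-comm : ∀ p q → p *F q ≈F q *F p
  *F-comm (np , dp , _) (nq , dq , _) =
    solve 4 (λ np dp nq dq → (np :* nq) :* (dq :* dp) := (nq :* np) :* (dp :* dq)) refl np dp nq dq

  *F-identityˡ : ∀ p → 1F *F p ≈F p
  *F-identityˡ (np , dp , _) =
    solve 2 (λ np dp → (con (1 , 0) :* np) :* dp := np :* (con (1 , 0) :* dp)) refl np dp

  *F-identityʳ : ∀ p → p *F 1F ≈F p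
  *F-identityʳ (np , dp , _) =
    solve 2 (λ np dp → (np :* con (1 , 0)) :* dp := np :* (dp :* con (1 , 0))) refl np dp

  *F-distribˡ-+F : ∀ p q r → p *F (q +F r) ≈F (p *F q) +F (p *F r)
  *F-distribˡ-+F (np , dp , _) (nq , dq , _) (nr , dr , _) =
    solve 6 (λ np dp nq dq nr dr → (np :* (nq :* dr :+ nr :* dq)) :* ((dp :* dq) :* (dp :* dr))
                                    := ((np :* nq) :* (dp :* dr) :+ (np :* nr) :* (dp :* dq)) :* (dp :* (dq :* dr)))
            refl np dp nq dq nr dr

  *F-distribʳ-+F : ∀ p q r → (q +F r) *F p ≈F (q *F p) +F (r *F p)
  *F-distribʳ-+F (np , dp , _) (nq , dq , _) (nr , dr , _) =
    solve 6 (λ np dp nq dq nr dr → ((nq :* dr :+ nr :* dq) :* np) :* ((dq :* dp) :* (dr :* dp))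
                                    := ((nq :* np) :* (dr :* dp) :+ (nr :* np) :* (dq :* dp)) :* ((dq :* dr) :* dp))
            refl np dp nq dq nr dr

  F-isCommutativeRing : IsCommutativeRing _≈F_ _+F_ _*F_ -F_ 0F 1F
  F-isCommutativeRing = record
    { isRing = record
      { +-isAbelianGroup = record
        { isGroup = record
          { isMonoid = record
            { isSemigroup = record
              { isMagma = record
                { isEquivalence = record { refl = refl ; sym = sym ; trans = λ {p} {q} {r} → ≈F-trans {p} {q} {r} }
                ; ∙-cong = λ {p} {p′} {q} {q′} → +F-cong {p} {p′} {q} {q′}
                }
              ; assoc = +F-assoc
              }
            ; identity = +F-identityˡ , +F-identityʳ
            }
          ; inverse = -F-inverseˡ , -F-inverseʳ
          ; ⁻¹-cong = λ {p} {p′} → -F-cong {p} {p′}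
          }
        ; comm = +F-comm
        }
      ; *-cong = λ {p} {p′} {q} {q′} → *F-cong {p} {p′} {q} {q′}
      ; *-assoc = *F-assoc
      ; *-identity = *F-identityˡ , *F-identityʳ
      ; distrib = *F-distribˡ-+F , *F-distribʳ-+F
      }
    ; *-comm = *F-comm
    }

  F-commutativeRing : CommutativeRing (c ⊔ ℓ) ℓ
  F-commutativeRing = record { isCommutativeRing = F-isCommutativeRing }

  F-noZeroDivisors : NoZeroDivisors F-commutativeRing
  F-noZeroDivisors (np , dp , _) (nq , dq , _) e with nzd np nq (trans (sym (*-identityʳ _)) (trans e (zeroˡ _)))
  ... | inj₁ np≈0 = inj₁ (trans (*-identityʳ np) (trans np≈0 (sym (zeroˡ dp))))
  ... | inj₂ nq≈0 = inj₂ (trans (*-identityʳ nq) (trans nq≈0 (sym (zeroˡ dq))))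

module LaplaceDeterminant {c ℓ} (R : CommutativeRing c ℓ) where
  open CommutativeRing R hiding (zero)
  open IntegerRingSolver R
  open RawOps _+_ _*_ -_ 0# 1# public
  open import Algebra.Properties.Ring ring using (-0#≈0#; -‿distribʳ-*)
  open import Relation.Binary.Reasoning.Setoid setoid

  Matrix : ℕ → ℕ → Set c
  Matrix m n = Fin m → Fin n → Carrier

  minor : ∀ {m n} → Matrix (suc m) (suc n) → Fin (suc n) → Matrix m n
  minor A j r c = A (suc r) (punchIn j c)

  [_∣_] : ∀ {m n} → (Fin m → Carrier) → Matrix m n → Matrix m (suc n)
  [ v ∣ A ] r zero = v r
  [ v ∣ A ] r (suc c) = A r c

  negPow-cong : ∀ k {x y} → x ≈ y → negPow k x ≈ negPow k y
  negPow-cong zero e = e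
  negPow-cong (suc k) e = -‿cong (negPow-cong k e)

  negPow-linear : ∀ k l m x y → negPow k (l * x + m * y) ≈ l * negPow k x + m * negPow k y
  negPow-linear zero l m x y = refl
  negPow-linear (suc k) l m x y = trans (-‿cong (negPow-linear k l m x y))
    (solve 4 (λ l m x y → :- (l :* x :+ m :* y) := l :* (:- x) :+ m :* (:- y)) refl l m (negPow k x) (negPow k y))

  negPow-neg : ∀ k x → negPow k (- x) ≈ - negPow k x
  negPow-neg zero x = refl
  negPow-neg (suc k) x = -‿cong (negPow-neg k x)

  negPow-zero : ∀ k → negPow k 0# ≈ 0#
  negPow-zero zero = refl
  negPow-zero (suc k) = trans (-‿cong (negPow-zero k)) -0#≈0#

  sumFin-cong : ∀ n {f g : Fin n → Carrier} → (∀ i → f i ≈ g i) → sumFin n f ≈ sumFin n g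
  sumFin-cong zero e = refl
  sumFin-cong (suc n) e = +-cong (e zero) (sumFin-cong n (λ i → e (suc i)))

  sumFin-linear : ∀ n l m (f g : Fin n → Carrier) →
                  sumFin n (λ i → l * f i + m * g i) ≈ l * sumFin n f + m * sumFin n g
  sumFin-linear zero l m f g = solve 2 (λ l m → con (0 , 0) := l :* con (0 , 0) :+ m :* con (0 , 0)) refl l m
  sumFin-linear (suc n) l m f g = trans (+-congˡ (sumFin-linear n l m (tail f) (tail g)))
    (solve 6 (λ l m a b s t → (l :* a :+ m :* b) :+ (l :* s :+ m :* t) := l :* (a :+ s) :+ m :* (b :+ t))
           refl l m (f zero) (g zero) (sumFin n (tail f)) (sumFin n (tail g)))

  sumFin-neg : ∀ n (f : Fin n → Carrier) → sumFin n (λ i → - f i) ≈ - sumFin n f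
  sumFin-neg zero f = sym -0#≈0#
  sumFin-neg (suc n) f = trans (+-congˡ (sumFin-neg n (tail f)))
    (solve 2 (λ a s → :- a :+ :- s := :- (a :+ s)) refl (f zero) (sumFin n (tail f)))

  sumFin-zero : ∀ n {f : Fin n → Carrier} → (∀ i → f i ≈ 0#) → sumFin n f ≈ 0#
  sumFin-zero zero z = refl
  sumFin-zero (suc n) z = trans (+-cong (z zero) (sumFin-zero n (λ i → z (suc i)))) (+-identityʳ 0#)

  -- det (suc n) A is definitionally signedSum (suc n) toℕ (A zero) (λ j → det n (minor A j)).
  signedSum : ∀ n → (Fin n → ℕ) → (Fin n → Carrier) → (Fin n → Carrier) → Carrier
  signedSum n e a d = sumFin n (λ j → negPow (e j) (a j * d j))

  module _ (n : ℕ) (e : Fin n → ℕ) (a : Fin n → Carrier) where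

    signedSum-cong : ∀ {d d′} → (∀ j → d j ≈ d′ j) → signedSum n e a d ≈ signedSum n e a d′
    signedSum-cong d≈d′ = sumFin-cong n (λ j → negPow-cong (e j) (*-congˡ (d≈d′ j)))

    signedSum-linear : ∀ l m d d′ →
      signedSum n e a (λ j → l * d j + m * d′ j) ≈ l * signedSum n e a d + m * signedSum n e a d′
    signedSum-linear l m d d′ = trans (sumFin-cong n (λ j → trans
        (negPow-cong (e j) (solve 5 (λ a l m x y → a :* (l :* x :+ m :* y) := l :* (a :* x) :+ m :* (a :* y))
                                  refl (a j) l m (d j) (d′ j)))
        (negPow-linear (e j) l m (a j * d j) (a j * d′ j))))
      (sumFin-linear n l m (λ j → negPow (e j) (a j * d j)) (λ j → negPow (e j) (a j * d′ j)))

    signedSum-*ˡ : ∀ b d → signedSum n e a (λ j → b * d j) ≈ b * signedSum n e a d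
    signedSum-*ˡ b d = begin
      signedSum n e a (λ j → b * d j)
        ≈⟨ signedSum-cong (λ j → solve 2 (λ b x → b :* x := b :* x :+ con (0 , 0) :* x) refl b (d j)) ⟩
      signedSum n e a (λ j → b * d j + 0# * d j)
        ≈⟨ signedSum-linear b 0# d d ⟩
      b * signedSum n e a d + 0# * signedSum n e a d
        ≈⟨ solve 2 (λ b s → b :* s :+ con (0 , 0) :* s := b :* s) refl b (signedSum n e a d) ⟩
      b * signedSum n e a d ∎

    signedSum-neg : ∀ {d d′} → (∀ j → d′ j ≈ - d j) → signedSum n e a d′ ≈ - signedSum n e a d
    signedSum-neg {d} d′≈-d = trans
      (sumFin-cong n (λ j → trans (negPow-cong (e j) (trans (*-congˡ (d′≈-d j)) (sym (-‿distribʳ-* (a j) (d j)))))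
                                  (negPow-neg (e j) (a j * d j))))
      (sumFin-neg n (λ j → negPow (e j) (a j * d j)))

    signedSum-zero : ∀ {d} → (∀ j → d j ≈ 0#) → signedSum n e a d ≈ 0#
    signedSum-zero d≈0 =
      sumFin-zero n (λ j → trans (negPow-cong (e j) (trans (*-congˡ (d≈0 j)) (zeroʳ (a j)))) (negPow-zero (e j)))

  signedSum-suc : ∀ n e a d → signedSum n (λ j → suc (e j)) a d ≈ - signedSum n e a d
  signedSum-suc n e a d = sumFin-neg n (λ j → negPow (e j) (a j * d j))

  det-cong : ∀ n {A B : Matrix n n} → (∀ r c → A r c ≈ B r c) → det n A ≈ det n B
  det-cong zero e = refl
  det-cong (suc n) e = sumFin-cong (suc n) (λ j → negPow-cong (toℕ j)
    (*-cong (e zero j) (det-cong n (λ r c → e (suc r) (punchIn j c)))))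

  det-cong₀ : ∀ n {v w} (A : Matrix (suc n) n) → (∀ r → v r ≈ w r) → det (suc n) [ v ∣ A ] ≈ det (suc n) [ w ∣ A ]
  det-cong₀ n {v} {w} A v≈w = det-cong (suc n) {[ v ∣ A ]} {[ w ∣ A ]} (λ { r zero → v≈w r ; r (suc c) → refl })

  det-1×1 : ∀ (A : Matrix 1 1) → det 1 A ≈ A zero zero
  det-1×1 A = trans (+-identityʳ _) (*-identityʳ _)

  det-expansion : ∀ n v (A : Matrix (suc (suc n)) (suc n)) →
    det (suc (suc n)) [ v ∣ A ] ≈
    v zero * det (suc n) (tail A) + signedSum (suc n) (λ j → suc (toℕ j)) (A zero) (λ j → det (suc n) [ tail v ∣ minor A j ])
  det-expansion n v A = +-congˡ (signedSum-cong (suc n) (λ j → suc (toℕ j)) (A zero)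
    (λ j → det-cong (suc n) {minor [ v ∣ A ] (suc j)} {[ tail v ∣ minor A j ]} (λ { r zero → refl ; r (suc c) → refl })))

  cofactorsFrom₂ : ∀ n → (v w : Fin (suc (suc n)) → Carrier) → Matrix (suc (suc n)) n → Carrier
  cofactorsFrom₂ zero v w B = 0#
  cofactorsFrom₂ (suc n) v w B =
    signedSum (suc n) (λ j → suc (suc (toℕ j))) (B zero) (λ j → det (suc (suc n)) [ tail v ∣ [ tail w ∣ minor B j ] ])

  det-expansion₂ : ∀ n v w (B : Matrix (suc (suc n)) n) →
    det (suc (suc n)) [ v ∣ [ w ∣ B ] ] ≈
    v zero * det (suc n) [ tail w ∣ tail B ] + (- (w zero * det (suc n) [ tail v ∣ tail B ]) + cofactorsFrom₂ n v w B)
  det-expansion₂ n v w B =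
    +-cong (*-congˡ (det-cong (suc n) {minor M zero} {[ tail w ∣ tail B ]} (λ { r zero → refl ; r (suc c) → refl })))
           (+-cong (-‿cong (*-congˡ (det-cong (suc n) {minor M (suc zero)} {[ tail v ∣ tail B ]} (λ { r zero → refl ; r (suc c) → refl }))))
                   (later n v w B))
    where
    M : Matrix (suc (suc n)) (suc (suc n))
    M = [ v ∣ [ w ∣ B ] ]
    later : ∀ n v w (B : Matrix (suc (suc n)) n) →
      signedSum n (λ j → suc (suc (toℕ j))) (B zero) (λ j → det (suc n) (minor [ v ∣ [ w ∣ B ] ] (suc (suc j))))
      ≈ cofactorsFrom₂ n v w B
    later zero v w B = refl
    later (suc n) v w B = signedSum-cong (suc n) (λ j → suc (suc (toℕ j))) (B zero)
      (λ j → det-cong (suc (suc n)) {minor [ v ∣ [ w ∣ B ] ] (suc (suc j))} {[ tail v ∣ [ tail w ∣ minor B j ] ]}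
                      (λ { r zero → refl ; r (suc zero) → refl ; r (suc (suc c)) → refl }))

  det-linear : ∀ n l m u w (A : Matrix (suc n) n) →
    det (suc n) [ (λ r → l * u r + m * w r) ∣ A ] ≈ l * det (suc n) [ u ∣ A ] + m * det (suc n) [ w ∣ A ]
  det-linear zero l m u w A =
    solve 4 (λ l u m w → (l :* u :+ m :* w) :* con (1 , 0) :+ con (0 , 0)
                         := l :* (u :* con (1 , 0) :+ con (0 , 0)) :+ m :* (w :* con (1 , 0) :+ con (0 , 0)))
          refl l (u zero) m (w zero)
  det-linear (suc n) l m u w A = begin
    det (suc (suc n)) [ (λ r → l * u r + m * w r) ∣ A ]
      ≈⟨ det-expansion n (λ r → l * u r + m * w r) A ⟩
    (l * u zero + m * w zero) * D + signedSum (suc n) e (A zero) (λ j → det (suc n) [ (λ r → l * u (suc r) + m * w (suc r)) ∣ minor A j ])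
      ≈⟨ +-congˡ (trans (signedSum-cong (suc n) e (A zero) (λ j → det-linear n l m (tail u) (tail w) (minor A j)))
                        (signedSum-linear (suc n) e (A zero) l m
                          (λ j → det (suc n) [ tail u ∣ minor A j ]) (λ j → det (suc n) [ tail w ∣ minor A j ]))) ⟩
    (l * u zero + m * w zero) * D + (l * Sᵤ + m * S_w)
      ≈⟨ solve 7 (λ l m a b d s t → (l :* a :+ m :* b) :* d :+ (l :* s :+ m :* t) := l :* (a :* d :+ s) :+ m :* (b :* d :+ t))
               refl l m (u zero) (w zero) D Sᵤ S_w ⟩
    l * (u zero * D + Sᵤ) + m * (w zero * D + S_w)
      ≈⟨ +-cong (*-congˡ (det-expansion n u A)) (*-congˡ (det-expansion n w A)) ⟨
    l * det (suc (suc n)) [ u ∣ A ] + m * det (suc (suc n)) [ w ∣ A ] ∎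
    where
    e : Fin (suc n) → ℕ
    e j = suc (toℕ j)
    D Sᵤ S_w : Carrier
    D = det (suc n) (tail A)
    Sᵤ = signedSum (suc n) e (A zero) (λ j → det (suc n) [ tail u ∣ minor A j ])
    S_w = signedSum (suc n) e (A zero) (λ j → det (suc n) [ tail w ∣ minor A j ])

  det-zeroColumn : ∀ n v (A : Matrix (suc n) n) → (∀ r → v r ≈ 0#) → det (suc n) [ v ∣ A ] ≈ 0#
  det-zeroColumn n v A v≈0 = begin
    det (suc n) [ v ∣ A ]
      ≈⟨ det-cong₀ n A (λ r → trans (v≈0 r) (solve 1 (λ x → con (0 , 0) := con (0 , 0) :* x :+ con (0 , 0) :* x) refl (v r))) ⟩
    det (suc n) [ (λ r → 0# * v r + 0# * v r) ∣ A ]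
      ≈⟨ det-linear n 0# 0# v v A ⟩
    0# * det (suc n) [ v ∣ A ] + 0# * det (suc n) [ v ∣ A ]
      ≈⟨ solve 1 (λ d → con (0 , 0) :* d :+ con (0 , 0) :* d := con (0 , 0)) refl (det (suc n) [ v ∣ A ]) ⟩
    0# ∎

  det-column₀-e₀ : ∀ n v (A : Matrix (suc n) n) → (∀ r → v (suc r) ≈ 0#) →
    det (suc n) [ v ∣ A ] ≈ v zero * det n (tail A)
  det-column₀-e₀ zero v A _ = +-identityʳ _
  det-column₀-e₀ (suc n) v A v≈0 = trans (det-expansion n v A)
    (trans (+-congˡ (signedSum-zero (suc n) (λ j → suc (toℕ j)) (A zero) (λ j → det-zeroColumn n (tail v) (minor A j) v≈0)))
           (+-identityʳ _))

  det-column₀-e₁ : ∀ n v (A : Matrix (suc (suc n)) (suc n)) → v zero ≈ 0# → (∀ r → v (suc (suc r)) ≈ 0#) →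
    det (suc (suc n)) [ v ∣ A ] ≈ - (v (suc zero) * det (suc n) (removeAt A (suc zero)))
  det-column₀-e₁ n v A v₀≈0 v≈0 = begin
    det (suc (suc n)) [ v ∣ A ]
      ≈⟨ det-expansion n v A ⟩
    v zero * det (suc n) (tail A) + signedSum (suc n) (λ j → suc (toℕ j)) (A zero) (λ j → det (suc n) [ tail v ∣ minor A j ])
      ≈⟨ +-cong (trans (*-congʳ v₀≈0) (zeroˡ _))
                (signedSum-cong (suc n) (λ j → suc (toℕ j)) (A zero) (λ j → det-column₀-e₀ n (tail v) (minor A j) v≈0)) ⟩
    0# + signedSum (suc n) (λ j → suc (toℕ j)) (A zero) (λ j → v (suc zero) * det n (tail (minor A j)))
      ≈⟨ +-identityˡ _ ⟩
    signedSum (suc n) (λ j → suc (toℕ j)) (A zero) (λ j → v (suc zero) * det n (tail (minor A j)))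
      ≈⟨ signedSum-suc (suc n) toℕ (A zero) (λ j → v (suc zero) * det n (tail (minor A j))) ⟩
    - signedSum (suc n) toℕ (A zero) (λ j → v (suc zero) * det n (tail (minor A j)))
      ≈⟨ -‿cong (signedSum-*ˡ (suc n) toℕ (A zero) (v (suc zero)) (λ j → det n (tail (minor A j)))) ⟩
    - (v (suc zero) * det (suc n) (removeAt A (suc zero))) ∎

  det-swap₀₁ : ∀ n v w (B : Matrix (suc (suc n)) n) →
    det (suc (suc n)) [ w ∣ [ v ∣ B ] ] ≈ - det (suc (suc n)) [ v ∣ [ w ∣ B ] ]
  det-swap₀₁ n v w B = begin
    det (suc (suc n)) [ w ∣ [ v ∣ B ] ]
      ≈⟨ det-expansion₂ n w v B ⟩
    w zero * Dᵥ + (- (v zero * D_w) + cofactorsFrom₂ n w v B)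
      ≈⟨ +-congˡ (+-congˡ (swapped n)) ⟩
    w zero * Dᵥ + (- (v zero * D_w) + - cofactorsFrom₂ n v w B)
      ≈⟨ solve 5 (λ a x b y s → a :* x :+ (:- (b :* y) :+ :- s) := :- (b :* y :+ (:- (a :* x) :+ s)))
               refl (w zero) Dᵥ (v zero) D_w (cofactorsFrom₂ n v w B) ⟩
    - (v zero * D_w + (- (w zero * Dᵥ) + cofactorsFrom₂ n v w B))
      ≈⟨ -‿cong (det-expansion₂ n v w B) ⟨
    - det (suc (suc n)) [ v ∣ [ w ∣ B ] ] ∎
    where
    Dᵥ D_w : Carrier
    Dᵥ = det (suc n) [ tail v ∣ tail B ]
    D_w = det (suc n) [ tail w ∣ tail B ]
    swapped : ∀ n {v w} {B : Matrix (suc (suc n)) n} → cofactorsFrom₂ n w v B ≈ - cofactorsFrom₂ n v w B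
    swapped zero = sym -0#≈0#
    swapped (suc n) {v} {w} {B} = signedSum-neg (suc n) (λ j → suc (suc (toℕ j))) (B zero)
      (λ j → det-swap₀₁ n (tail v) (tail w) (minor B j))

  det-equal₀₁ : ∀ n v (B : Matrix (suc (suc n)) n) → det (suc (suc n)) [ v ∣ [ v ∣ B ] ] ≈ 0#
  det-equal₀₁ n v B = begin
    det (suc (suc n)) [ v ∣ [ v ∣ B ] ]
      ≈⟨ det-expansion₂ n v v B ⟩
    v zero * D + (- (v zero * D) + cofactorsFrom₂ n v v B)
      ≈⟨ +-congˡ (+-congˡ (later-vanish n)) ⟩
    v zero * D + (- (v zero * D) + 0#)
      ≈⟨ solve 1 (λ x → x :+ (:- x :+ con (0 , 0)) := con (0 , 0)) refl (v zero * D) ⟩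
    0# ∎
    where
    D : Carrier
    D = det (suc n) [ tail v ∣ tail B ]
    later-vanish : ∀ n {v} {B : Matrix (suc (suc n)) n} → cofactorsFrom₂ n v v B ≈ 0#
    later-vanish zero = refl
    later-vanish (suc n) {v} {B} = signedSum-zero (suc n) (λ j → suc (suc (toℕ j))) (B zero)
      (λ j → det-equal₀₁ n (tail v) (minor B j))

  det-equal₀₂ : ∀ n v w (B : Matrix (suc (suc (suc n))) n) →
    det (suc (suc (suc n))) [ v ∣ [ w ∣ [ v ∣ B ] ] ] ≈ 0#
  det-equal₀₂ n v w B = begin
    det (suc (suc (suc n))) [ v ∣ [ w ∣ [ v ∣ B ] ] ]
      ≈⟨ det-expansion₂ (suc n) v w [ v ∣ B ] ⟩
    v zero * det (suc (suc n)) [ tail w ∣ tail [ v ∣ B ] ]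
      + (- (w zero * det (suc (suc n)) [ tail v ∣ tail [ v ∣ B ] ])
         + (- - (v zero * D) + cofactorsFrom₃))
      ≈⟨ +-cong (*-congˡ (trans (det-cong (suc (suc n)) {[ tail w ∣ tail [ v ∣ B ] ]} {[ tail w ∣ [ tail v ∣ tail B ] ]}
                                            (λ { r zero → refl ; r (suc zero) → refl ; r (suc (suc c)) → refl }))
                                (det-swap₀₁ n (tail v) (tail w) (tail B))))
                (+-cong (-‿cong (*-congˡ (trans (det-cong (suc (suc n)) {[ tail v ∣ tail [ v ∣ B ] ]} {[ tail v ∣ [ tail v ∣ tail B ] ]}
                                                             (λ { r zero → refl ; r (suc zero) → refl ; r (suc (suc c)) → refl }))
                                                 (det-equal₀₁ n (tail v) (tail B)))))
                        (+-congˡ (later-vanish n v w B))) ⟩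
    v zero * - D + (- (w zero * 0#) + (- - (v zero * D) + 0#))
      ≈⟨ solve 3 (λ a b d → a :* :- d :+ (:- (b :* con (0 , 0)) :+ (:- :- (a :* d) :+ con (0 , 0))) := con (0 , 0))
               refl (v zero) (w zero) D ⟩
    0# ∎
    where
    D : Carrier
    D = det (suc (suc n)) [ tail v ∣ [ tail w ∣ tail B ] ]
    cofactorsFrom₃ : Carrier
    cofactorsFrom₃ = signedSum n (λ j → suc (suc (suc (toℕ j)))) (B zero)
                        (λ j → det (suc (suc n)) [ tail v ∣ [ tail w ∣ minor [ v ∣ B ] (suc j) ] ])
    later-vanish : ∀ n v w (B : Matrix (suc (suc (suc n))) n) →
      signedSum n (λ j → suc (suc (suc (toℕ j)))) (B zero)
        (λ j → det (suc (suc n)) [ tail v ∣ [ tail w ∣ minor [ v ∣ B ] (suc j) ] ]) ≈ 0#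
    later-vanish zero v w B = refl
    later-vanish (suc n) v w B = signedSum-zero (suc n) (λ j → suc (suc (suc (toℕ j)))) (B zero) (λ j →
      trans (det-cong (suc (suc (suc n))) {[ tail v ∣ [ tail w ∣ minor [ v ∣ B ] (suc j) ] ]}
                                           {[ tail v ∣ [ tail w ∣ [ tail v ∣ minor B j ] ] ]}
                      (λ { r zero → refl ; r (suc zero) → refl ; r (suc (suc zero)) → refl ; r (suc (suc (suc c))) → refl }))
            (det-equal₀₂ n (tail v) (tail w) (minor B j)))

  det-columnOperation : ∀ n α β γ u v w (B : Matrix (suc (suc (suc n))) n) →
    det (suc (suc (suc n))) [ (λ r → α * u r + (β * v r + γ * w r)) ∣ [ v ∣ [ w ∣ B ] ] ]
    ≈ α * det (suc (suc (suc n))) [ u ∣ [ v ∣ [ w ∣ B ] ] ]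
  det-columnOperation n α β γ u v w B = begin
    det N [ (λ r → α * u r + (β * v r + γ * w r)) ∣ A ]
      ≈⟨ det-cong₀ (suc (suc n)) A (λ r → +-congˡ (sym (*-identityˡ _))) ⟩
    det N [ (λ r → α * u r + 1# * (β * v r + γ * w r)) ∣ A ]
      ≈⟨ det-linear (suc (suc n)) α 1# u (λ r → β * v r + γ * w r) A ⟩
    α * det N [ u ∣ A ] + 1# * det N [ (λ r → β * v r + γ * w r) ∣ A ]
      ≈⟨ +-congˡ (*-congˡ (det-linear (suc (suc n)) β γ v w A)) ⟩
    α * det N [ u ∣ A ] + 1# * (β * det N [ v ∣ A ] + γ * det N [ w ∣ A ])
      ≈⟨ +-congˡ (*-congˡ (+-cong (*-congˡ (det-equal₀₁ (suc n) v [ w ∣ B ])) (*-congˡ (det-equal₀₂ n w v B)))) ⟩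
    α * det N [ u ∣ A ] + 1# * (β * 0# + γ * 0#)
      ≈⟨ solve 4 (λ a d b g → a :* d :+ con (1 , 0) :* (b :* con (0 , 0) :+ g :* con (0 , 0)) := a :* d)
               refl α (det N [ u ∣ A ]) β γ ⟩
    α * det N [ u ∣ A ] ∎
    where
    N : ℕ
    N = suc (suc (suc n))
    A : Matrix N (suc (suc n))
    A = [ v ∣ [ w ∣ B ] ]

module Frieze {c ℓ} (R : CommutativeRing c ℓ) (nzd : NoZeroDivisors R) where
  open CommutativeRing R hiding (zero)
  open IntegerRingSolver R
  open IntegralDomain R nzd
  open LaplaceDeterminant R
  open import Relation.Binary.Reasoning.Setoid setoid

  negTwoPow : ℕ → Carrier
  negTwoPow zero = 1#
  negTwoPow (suc t) = - (1# + 1#) * negTwoPow t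

  combinations-proportional : ∀ α β γ t p q r p′ q′ r′ →
    p * q′ - p′ * q ≈ t * γ → q * r′ - q′ * r ≈ t * α →
    q′ * (α * p + (β * q + γ * r)) ≈ q * (α * p′ + (β * q′ + γ * r′))
  combinations-proportional α β γ t p q r p′ q′ r′ e₁ e₂ = begin
    q′ * (α * p + (β * q + γ * r))
      ≈⟨ solve 9 (λ α β γ p q r p′ q′ r′ →
                   q′ :* (α :* p :+ (β :* q :+ γ :* r))
                   := q :* (α :* p′ :+ (β :* q′ :+ γ :* r′)) :+ (α :* (p :* q′ :- p′ :* q) :- γ :* (q :* r′ :- q′ :* r)))
               refl α β γ p q r p′ q′ r′ ⟩
    q * (α * p′ + (β * q′ + γ * r′)) + (α * (p * q′ - p′ * q) - γ * (q * r′ - q′ * r))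
      ≈⟨ +-congˡ (+-cong (*-congˡ e₁) (-‿cong (*-congˡ e₂))) ⟩
    q * (α * p′ + (β * q′ + γ * r′)) + (α * (t * γ) - γ * (t * α))
      ≈⟨ solve 5 (λ c α γ t q → q :* c :+ (α :* (t :* γ) :- γ :* (t :* α)) := q :* c) refl _ α γ t q ⟩
    q * (α * p′ + (β * q′ + γ * r′)) ∎

  module Determinant {s : ℕ} (M : Fin (suc (suc s)) → Fin (suc (suc s)) → Carrier)
    (symmetric : ∀ i j → M i j ≈ M j i)
    (zero⇒diag : ∀ i j → M i j ≈ 0# → i ≡ j)
    (diag⇒zero : ∀ i → M i i ≈ 0#)
    (diamond : ∀ i i′ j j′ → toℕ i′ ≡ suc (toℕ i) → toℕ j′ ≡ suc (toℕ j) → toℕ i < toℕ j →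
               M i j * M i′ j′ - M i′ j * M i j′ ≈ M i i′ * M j j′)
    where

    n : ℕ
    n = suc (suc s)

    m : ℕ → ℕ → Carrier
    m a b with a <? n | b <? n
    ... | yes a<n | yes b<n = M (fromℕ< a<n) (fromℕ< b<n)
    ... | _       | _       = 0#

    m-fromℕ< : ∀ {a b} (a<n : a < n) (b<n : b < n) → m a b ≈ M (fromℕ< a<n) (fromℕ< b<n)
    m-fromℕ< {a} {b} a<n b<n with a <? n | b <? n
    ... | yes _  | yes _  = refl
    ... | yes _  | no b≮n = contradiction b<n b≮n
    ... | no a≮n | _      = contradiction a<n a≮n

    m-toℕ : ∀ i j → m (toℕ i) (toℕ j) ≈ M i j
    m-toℕ i j = trans (m-fromℕ< (toℕ<n i) (toℕ<n j))
                      (reflexive (≡.cong₂ M (fromℕ<-toℕ i (toℕ<n i)) (fromℕ<-toℕ j (toℕ<n j))))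

    m-sym : ∀ a b → m a b ≈ m b a
    m-sym a b with a <? n | b <? n
    ... | yes a<n | yes b<n = symmetric (fromℕ< a<n) (fromℕ< b<n)
    ... | yes _   | no _    = refl
    ... | no _    | yes _   = refl
    ... | no _    | no _    = refl

    m-diag : ∀ a → m a a ≈ 0#
    m-diag a with a <? n
    ... | yes a<n = diag⇒zero (fromℕ< a<n)
    ... | no _    = refl

    m-outside : ∀ {a} b → ¬ a < n → m a b ≈ 0#
    m-outside {a} b a≮n with a <? n
    ... | yes a<n = contradiction a<n a≮n
    ... | no _    = refl

    m-nonzero : ∀ {a b} → a < n → b < n → a ≢ b → ¬ m a b ≈ 0#
    m-nonzero a<n b<n a≢b mab≈0 = a≢b (≡.trans (≡.sym (toℕ-fromℕ< a<n))
      (≡.trans (≡.cong toℕ (zero⇒diag _ _ (trans (sym (m-fromℕ< a<n b<n)) mab≈0))) (toℕ-fromℕ< b<n)))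

    x : ℕ → Carrier
    x a = m a (suc a)

    m-diamond : ∀ {a b} → a < b → suc b < n →
                m a b * m (suc a) (suc b) - m (suc a) b * m a (suc b) ≈ x a * x b
    m-diamond {a} {b} a<b sb<n = begin
      m a b * m (suc a) (suc b) - m (suc a) b * m a (suc b)
        ≈⟨ +-cong (*-cong (m-fromℕ< a<n b<n) (m-fromℕ< sa<n sb<n))
                  (-‿cong (*-cong (m-fromℕ< sa<n b<n) (m-fromℕ< a<n sb<n))) ⟩
      M i j * M i′ j′ - M i′ j * M i j′
        ≈⟨ diamond i i′ j j′ (toℕ-suc a<n sa<n) (toℕ-suc b<n sb<n)
                   (≡.subst₂ _<_ (≡.sym (toℕ-fromℕ< a<n)) (≡.sym (toℕ-fromℕ< b<n)) a<b) ⟩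
      M i i′ * M j j′
        ≈⟨ *-cong (m-fromℕ< a<n sa<n) (m-fromℕ< b<n sb<n) ⟨
      x a * x b ∎
      where
      b<n : b < n
      b<n = ℕ.<⇒≤ sb<n
      sa<n : suc a < n
      sa<n = ℕ.≤-trans (s≤s a<b) b<n
      a<n : a < n
      a<n = ℕ.<⇒≤ sa<n
      i i′ j j′ : Fin n
      i = fromℕ< a<n
      i′ = fromℕ< sa<n
      j = fromℕ< b<n
      j′ = fromℕ< sb<n
      toℕ-suc : ∀ {a} (a<n : a < n) (sa<n : suc a < n) → toℕ (fromℕ< sa<n) ≡ suc (toℕ (fromℕ< a<n))
      toℕ-suc a<n sa<n = ≡.trans (toℕ-fromℕ< sa<n) (≡.cong suc (≡.sym (toℕ-fromℕ< a<n)))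

    adjacentMinor : ∀ {a b} → a ≢ b → suc a < n → suc b < n →
                    m a b * m (suc a) (suc b) - m (suc a) b * m a (suc b) ≈ x a * x b
    adjacentMinor {a} {b} a≢b sa<n sb<n with ℕ.<-cmp a b
    ... | tri< a<b _ _ = m-diamond a<b sb<n
    ... | tri≈ _ a≡b _ = contradiction a≡b a≢b
    ... | tri> _ _ b<a = begin
      m a b * m (suc a) (suc b) - m (suc a) b * m a (suc b)
        ≈⟨ +-cong (*-cong (m-sym a b) (m-sym (suc a) (suc b)))
                  (-‿cong (trans (*-comm _ _) (*-cong (m-sym a (suc b)) (m-sym (suc a) b)))) ⟩
      m b a * m (suc b) (suc a) - m (suc b) a * m b (suc a)
        ≈⟨ m-diamond b<a sa<n ⟩
      x b * x a
        ≈⟨ *-comm (x b) (x a) ⟩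
      x a * x b ∎

    combination : ℕ → ℕ → Carrier
    combination k a = x (suc k) * m a k + (- m k (suc (suc k)) * m a (suc k) + x k * m a (suc (suc k)))

    combination-pivot : ∀ k → combination k (suc k) ≈ x (suc k) * x k + x k * x (suc k)
    combination-pivot k = begin
      x (suc k) * m (suc k) k + (- m k (suc (suc k)) * m (suc k) (suc k) + x k * x (suc k))
        ≈⟨ +-cong (*-congˡ (m-sym (suc k) k)) (+-congʳ (*-congˡ (m-diag (suc k)))) ⟩
      x (suc k) * x k + (- m k (suc (suc k)) * 0# + x k * x (suc k))
        ≈⟨ solve 3 (λ a b c → a :* b :+ (:- c :* con (0 , 0) :+ b :* a) := a :* b :+ b :* a)
                 refl (x (suc k)) (x k) (m k (suc (suc k))) ⟩
      x (suc k) * x k + x k * x (suc k) ∎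

    combination-step : ∀ {k a} → a ≢ k → a ≢ suc k → suc a < n → suc (suc k) < n →
                       m (suc a) (suc k) * combination k a ≈ m a (suc k) * combination k (suc a)
    combination-step {k} {a} a≢k a≢sk sa<n ssk<n =
      combinations-proportional (x (suc k)) (- m k (suc (suc k))) (x k) (x a)
        (m a k) (m a (suc k)) (m a (suc (suc k))) (m (suc a) k) (m (suc a) (suc k)) (m (suc a) (suc (suc k)))
        (adjacentMinor a≢k sa<n (ℕ.<⇒≤ ssk<n)) (adjacentMinor a≢sk sa<n ssk<n)

    combination-below : ∀ {k} → suc (suc k) < n → ∀ d a → d ℕ.+ a ≡ k → combination k a ≈ 0#
    combination-below {k} _ zero a ≡.refl = begin
      x (suc k) * m k k + (- m k (suc (suc k)) * x k + x k * m k (suc (suc k)))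
        ≈⟨ +-congʳ (*-congˡ (m-diag k)) ⟩
      x (suc k) * 0# + (- m k (suc (suc k)) * x k + x k * m k (suc (suc k)))
        ≈⟨ solve 3 (λ a b c → a :* con (0 , 0) :+ (:- b :* c :+ c :* b) := con (0 , 0)) refl (x (suc k)) (m k (suc (suc k))) (x k) ⟩
      0# ∎
    combination-below {k} ssk<n (suc d) a d+a≡k =
      *-cancelˡ-≈0 (m (suc a) (suc k)) (m-nonzero sa<n (ℕ.<⇒≤ ssk<n) (λ e → ℕ.<⇒≢ a<k (ℕ.suc-injective e)))
        (trans (combination-step (ℕ.<⇒≢ a<k) (ℕ.<⇒≢ (ℕ.m<n⇒m<1+n a<k)) sa<n ssk<n)
               (trans (*-congˡ (combination-below ssk<n d (suc a) (≡.trans (ℕ.+-suc d a) d+a≡k))) (zeroʳ _)))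
      where
      a<k : a < k
      a<k = ≡.subst (a <_) d+a≡k (s≤s (ℕ.m≤n+m a d))
      sa<n : suc a < n
      sa<n = ℕ.≤-trans (s≤s a<k) (ℕ.<⇒≤ (ℕ.<⇒≤ ssk<n))

    combination-above : ∀ {k} → suc (suc k) < n → ∀ d → combination k (d ℕ.+ suc (suc k)) ≈ 0#
    combination-above {k} _ zero = begin
      x (suc k) * m (suc (suc k)) k + (- m k (suc (suc k)) * m (suc (suc k)) (suc k) + x k * m (suc (suc k)) (suc (suc k)))
        ≈⟨ +-cong (*-congˡ (m-sym (suc (suc k)) k))
                  (+-cong (*-congˡ (m-sym (suc (suc k)) (suc k))) (*-congˡ (m-diag (suc (suc k))))) ⟩
      x (suc k) * m k (suc (suc k)) + (- m k (suc (suc k)) * x (suc k) + x k * 0#)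
        ≈⟨ solve 3 (λ a b c → a :* b :+ (:- b :* a :+ c :* con (0 , 0)) := con (0 , 0)) refl (x (suc k)) (m k (suc (suc k))) (x k) ⟩
      0# ∎
    combination-above {k} ssk<n (suc d) = next-row (suc b <? n)
      where
      b : ℕ
      b = d ℕ.+ suc (suc k)
      sk<b : suc k < b
      sk<b = ℕ.m≤n+m (suc (suc k)) d
      next-row : Dec (suc b < n) → combination k (suc b) ≈ 0#
      next-row (yes sb<n) =
        *-cancelˡ-≈0 (m b (suc k)) (m-nonzero (ℕ.<⇒≤ sb<n) (ℕ.<⇒≤ ssk<n) (ℕ.>⇒≢ sk<b))
          (trans (sym (combination-step (ℕ.>⇒≢ (ℕ.<-trans (ℕ.n<1+n k) sk<b)) (ℕ.>⇒≢ sk<b) sb<n ssk<n))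
                 (trans (*-congˡ (combination-above ssk<n d)) (zeroʳ _)))
      next-row (no sb≮n) = begin
        x (suc k) * m (suc b) k + (- m k (suc (suc k)) * m (suc b) (suc k) + x k * m (suc b) (suc (suc k)))
          ≈⟨ +-cong (*-congˡ (m-outside k sb≮n))
                    (+-cong (*-congˡ (m-outside (suc k) sb≮n)) (*-congˡ (m-outside (suc (suc k)) sb≮n))) ⟩
        x (suc k) * 0# + (- m k (suc (suc k)) * 0# + x k * 0#)
          ≈⟨ solve 3 (λ a b c → a :* con (0 , 0) :+ (:- b :* con (0 , 0) :+ c :* con (0 , 0)) := con (0 , 0))
                   refl (x (suc k)) (m k (suc (suc k))) (x k) ⟩
        0# ∎

    combination-vanishes : ∀ {k a} → suc (suc k) < n → a ≢ suc k → combination k a ≈ 0#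
    combination-vanishes {k} {a} ssk<n a≢sk with ℕ.<-cmp a (suc k)
    ... | tri< a<sk _ _ = combination-below ssk<n (k ℕ.∸ a) a (ℕ.m∸n+n≡m (ℕ.≤-pred a<sk))
    ... | tri≈ _ a≡sk _ = contradiction a≡sk a≢sk
    ... | tri> _ _ sk<a = ≡.subst (λ a → combination k a ≈ 0#) (ℕ.m∸n+n≡m sk<a)
                                  (combination-above ssk<n (a ℕ.∸ suc (suc k)))

    column : ∀ {t} → ℕ → Fin t → ℕ
    column k zero = k
    column k (suc c) = column (suc k) c

    row : ∀ {t} → ℕ → Fin t → ℕ
    row k zero = 0
    row k (suc r) = column (suc k) r

    column≡ : ∀ {t} k (c : Fin t) → column k c ≡ k ℕ.+ toℕ c
    column≡ k zero = ≡.sym (ℕ.+-identityʳ k)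
    column≡ k (suc c) = ≡.trans (column≡ (suc k) c) (≡.sym (ℕ.+-suc k (toℕ c)))

    k≤column : ∀ {t} k (c : Fin t) → k ≤ column k c
    k≤column k zero = ℕ.≤-refl
    k≤column k (suc c) = ℕ.≤-trans (ℕ.n≤1+n k) (k≤column (suc k) c)

    -- The t × t submatrix of m on the rows 0, k+1, …, k+t−1 and the columns k, …, k+t−1.
    block : ℕ → (t : ℕ) → Matrix t t
    block k t r c = m (row k r) (column k c)

    blockDet : ℕ → ℕ → Carrier
    blockDet k zero = - (m 0 (suc k) * x k)
    blockDet k (suc t) = - (1# + 1#) * x k * blockDet (suc k) t

    det-block : ∀ t k → suc (column k (fromℕ (suc t))) ≡ n →
                det (suc (suc t)) (block k (suc (suc t))) ≈ blockDet k t
    det-block zero k _ = begin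
      m 0 k * (m (suc k) (suc k) * 1# + 0#) + (- (m 0 (suc k) * (m (suc k) k * 1# + 0#)) + 0#)
        ≈⟨ +-cong (*-congˡ (+-congʳ (*-congʳ (m-diag (suc k)))))
                  (+-congʳ (-‿cong (*-congˡ (+-congʳ (*-congʳ (m-sym (suc k) k)))))) ⟩
      m 0 k * (0# * 1# + 0#) + (- (m 0 (suc k) * (x k * 1# + 0#)) + 0#)
        ≈⟨ solve 3 (λ a b c → a :* (con (0 , 0) :* con (1 , 0) :+ con (0 , 0))
                              :+ (:- (b :* (c :* con (1 , 0) :+ con (0 , 0))) :+ con (0 , 0))
                              := :- (b :* c))
                 refl (m 0 k) (m 0 (suc k)) (x k) ⟩
      - (m 0 (suc k) * x k) ∎
    det-block (suc t) k last≡ = *-cancelˡ-≈ (x (suc k)) x₁≉0 (begin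
      x (suc k) * det N (block k N)
        ≈⟨ *-congˡ (det-cong N {block k N} {[ u ∣ A ]}
                      (λ { r zero → refl ; r (suc zero) → refl ; r (suc (suc zero)) → refl ; r (suc (suc (suc c))) → refl })) ⟩
      x (suc k) * det N [ u ∣ A ]
        ≈⟨ det-columnOperation t (x (suc k)) (- m k (suc (suc k))) (x k) u v w rest ⟨
      det N [ (λ r → combination k (row k r)) ∣ A ]
        ≈⟨ det-column₀-e₁ (suc t) (λ r → combination k (row k r)) A
                          (combination-vanishes {a = 0} k+2<n (λ ())) (λ r → combination-vanishes k+2<n (far r)) ⟩
      - (combination k (suc k) * det (suc (suc t)) (removeAt A (suc zero)))
        ≈⟨ -‿cong (*-cong (combination-pivot k)
                          (trans (det-cong (suc (suc t)) {removeAt A (suc zero)} {block (suc k) (suc (suc t))} removeAt≈block)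
                                 (det-block t (suc k) last≡))) ⟩
      - ((x (suc k) * x k + x k * x (suc k)) * blockDet (suc k) t)
        ≈⟨ solve 3 (λ a b d → :- ((a :* b :+ b :* a) :* d) := a :* (:- (con (1 , 0) :+ con (1 , 0)) :* b :* d))
                 refl (x (suc k)) (x k) (blockDet (suc k) t) ⟩
      x (suc k) * blockDet k (suc t) ∎)
      where
      N : ℕ
      N = suc (suc (suc t))
      u v w : Fin N → Carrier
      u r = m (row k r) k
      v r = m (row k r) (suc k)
      w r = m (row k r) (suc (suc k))
      rest : Matrix N t
      rest r c = m (row k r) (column (suc (suc (suc k))) c)
      A : Matrix N (suc (suc t))
      A = [ v ∣ [ w ∣ rest ] ]
      k+2<n : suc (suc k) < n
      k+2<n = ℕ.≤-trans (s≤s (k≤column (suc (suc k)) (fromℕ t))) (ℕ.≤-reflexive last≡)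
      x₁≉0 : ¬ x (suc k) ≈ 0#
      x₁≉0 = m-nonzero (ℕ.<⇒≤ k+2<n) k+2<n (ℕ.<⇒≢ (ℕ.n<1+n (suc k)))
      far : ∀ r → column (suc (suc k)) r ≢ suc k
      far r e = ℕ.<-irrefl (≡.sym e) (k≤column (suc (suc k)) r)
      removeAt≈block : ∀ r c → removeAt A (suc zero) r c ≈ block (suc k) (suc (suc t)) r c
      removeAt≈block zero zero = refl
      removeAt≈block zero (suc zero) = refl
      removeAt≈block zero (suc (suc c)) = refl
      removeAt≈block (suc r) zero = refl
      removeAt≈block (suc r) (suc zero) = refl
      removeAt≈block (suc r) (suc (suc c)) = refl

    superdiagonal : ℕ → ℕ → Carrier
    superdiagonal k zero = 1#
    superdiagonal k (suc t) = x k * superdiagonal (suc k) t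

    blockDet-closedForm : ∀ t k →
      blockDet k t ≈ - ((negTwoPow t * m 0 (suc (column k (fromℕ t)))) * superdiagonal k (suc t))
    blockDet-closedForm zero k =
      solve 2 (λ a b → :- (a :* b) := :- ((con (1 , 0) :* a) :* (b :* con (1 , 0)))) refl (m 0 (suc k)) (x k)
    blockDet-closedForm (suc t) k = trans (*-congˡ (blockDet-closedForm t (suc k)))
      (solve 4 (λ b p a s → :- (con (1 , 0) :+ con (1 , 0)) :* b :* :- ((p :* a) :* s)
                            := :- ((:- (con (1 , 0) :+ con (1 , 0)) :* p :* a) :* (b :* s)))
             refl (x k) (negTwoPow t) (m 0 (suc (column (suc k) (fromℕ t)))) (superdiagonal (suc k) (suc t)))

    prodFin-superdiagonal : ∀ t k (f : Fin t → Carrier) → (∀ i → f i ≈ x (column k i)) →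
                            prodFin t f ≈ superdiagonal k t
    prodFin-superdiagonal zero k f _ = refl
    prodFin-superdiagonal (suc t) k f f≈ = *-cong (f≈ zero) (prodFin-superdiagonal t (suc k) (tail f) (λ i → f≈ (suc i)))

    det-frieze : det n M ≈ ((- negTwoPow s) * M zero (fromℕ (suc s))) * prodFin (suc s) (λ i → M (inject₁ i) (suc i))
    det-frieze = begin
      det n M
        ≈⟨ det-cong n {M} {block 0 n} M≈block ⟩
      det n (block 0 n)
        ≈⟨ det-block s 0 last≡ ⟩
      blockDet 0 s
        ≈⟨ blockDet-closedForm s 0 ⟩
      - ((negTwoPow s * m 0 (suc (column 0 (fromℕ s)))) * superdiagonal 0 (suc s))
        ≈⟨ -‿cong (*-cong (*-congˡ corner) (sym (prodFin-superdiagonal (suc s) 0 _ superdiagonal≈))) ⟩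
      - ((negTwoPow s * M zero (fromℕ (suc s))) * prodFin (suc s) (λ i → M (inject₁ i) (suc i)))
        ≈⟨ solve 3 (λ p a q → :- ((p :* a) :* q) := (:- p :* a) :* q) refl (negTwoPow s) (M zero (fromℕ (suc s))) _ ⟩
      ((- negTwoPow s) * M zero (fromℕ (suc s))) * prodFin (suc s) (λ i → M (inject₁ i) (suc i)) ∎
      where
      row₀≡ : ∀ {t} (r : Fin t) → row 0 r ≡ toℕ r
      row₀≡ zero = ≡.refl
      row₀≡ (suc r) = column≡ 1 r
      M≈block : ∀ r c → M r c ≈ block 0 n r c
      M≈block r c = trans (sym (m-toℕ r c)) (reflexive (≡.cong₂ m (≡.sym (row₀≡ r)) (≡.sym (column≡ 0 c))))
      last≡ : suc (column 0 (fromℕ (suc s))) ≡ n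
      last≡ = ≡.cong suc (≡.trans (column≡ 0 (fromℕ (suc s))) (toℕ-fromℕ (suc s)))
      corner : m 0 (suc (column 0 (fromℕ s))) ≈ M zero (fromℕ (suc s))
      corner = trans (reflexive (≡.cong (λ i → m 0 (suc i)) (column≡ 0 (fromℕ s)))) (m-toℕ zero (fromℕ (suc s)))
      superdiagonal≈ : ∀ i → M (inject₁ i) (suc i) ≈ x (column 0 i)
      superdiagonal≈ i = sym (trans
        (reflexive (≡.cong₂ (λ a b → m a (suc b)) (≡.trans (column≡ 0 i) (≡.sym (toℕ-inject₁ i))) (column≡ 0 i)))
        (m-toℕ (inject₁ i) (suc i)))

module FractionFieldFrieze {c ℓ} (R : CommutativeRing c ℓ)
                           (nt : IsNontrivial R) (nzd : NoZeroDivisors R) (ch : CharZero R) where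
  open FracChar0 R nt nzd ch public
  open FractionField R nt nzd public
  open LaplaceDeterminant F-commutativeRing public using (det-1×1)
  open Frieze F-commutativeRing F-noZeroDivisors public using (negTwoPow; module Determinant)
  open CommutativeRing F-commutativeRing using (refl; -_; _*_; -‿cong; *-cong; *-congʳ)

  -- _≈F_ unfolds to an equation between elements of R, so implicit arguments of the
  -- congruence lemmas cannot be inferred from it and are given explicitly.

  negTwoPowPred≈negTwoPow : ∀ t → negTwoPowPred (suc t) ≈F negTwoPow t
  negTwoPowPred≈negTwoPow zero = refl {1F}
  negTwoPowPred≈negTwoPow (suc t) =
    *-cong { -F two } { -F (1F +F 1F) } {negTwoPowPred (suc t)} {negTwoPow t} two≈ (negTwoPowPred≈negTwoPow t)
    where
    open CommutativeRing R using (1#) renaming (refl to refl-R)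
    open IntegerRingSolver R
    two : F
    two = RingNat.fromℕR R 2 , 1# , nt
    two≈ : -F two ≈F -F (1F +F 1F)
    two≈ = solve 0 (:- (con (1 , 0) :+ (con (1 , 0) :+ con (0 , 0))) :* (con (1 , 0) :* con (1 , 0))
                    := :- (con (1 , 0) :* con (1 , 0) :+ con (1 , 0) :* con (1 , 0)) :* con (1 , 0)) refl-R

  friezeDetRHS-suc : ∀ s (M : Fin (suc (suc s)) → Fin (suc (suc s)) → F) →
    friezeDetRHS (suc s) M ≈F ((- negTwoPow s) * M zero (fromℕ (suc s))) * prodFin (suc s) (λ i → M (inject₁ i) (suc i))
  friezeDetRHS-suc s M =
    *-congʳ {prodFin (suc s) (λ i → M (inject₁ i) (suc i))} {(- p) * a} {(- q) * a}
      (*-congʳ {a} { - p } { - q } (-‿cong {p} {q} (negTwoPowPred≈negTwoPow s)))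
    where
    a p q : F
    a = M zero (fromℕ (suc s))
    p = negTwoPowPred (suc s)
    q = negTwoPow s

theorem2p4 : ∀ {c ℓ} (R : CommutativeRing c ℓ)
             (nt : IsNontrivial R) (nzd : NoZeroDivisors R) (ch : CharZero R) →
             let open FracChar0 R nt nzd ch in
             ∀ (k : ℕ) (M : Fin (suc k) → Fin (suc k) → F) →
             IsFriezeMatrix (suc k) M →
             det (suc k) M ≈F friezeDetRHS k M
theorem2p4 R nt nzd ch zero M isFrieze = begin
    det 1 M                                             ≈⟨ det-1×1 M ⟩
    M zero zero                                         ≈⟨ diag⇒zero zero ⟩
    0F                                                  ≈⟨ zeroʳ (-F negTwoPowPred 0) ⟨
    (-F negTwoPowPred 0) *F 0F                          ≈⟨ *-congˡ { -F negTwoPowPred 0 } {M zero zero} {0F} (diag⇒zero zero) ⟨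
    (-F negTwoPowPred 0) *F M zero zero                 ≈⟨ *-identityʳ ((-F negTwoPowPred 0) *F M zero zero) ⟨
    friezeDetRHS zero M                                 ∎
  where
  open FractionFieldFrieze R nt nzd ch
  open CommutativeRing F-commutativeRing hiding (zero)
  open IsFriezeMatrix isFrieze
  open import Relation.Binary.Reasoning.Setoid setoid
theorem2p4 R nt nzd ch (suc s) M isFrieze = begin
    det (suc (suc s)) M
      ≈⟨ Determinant.det-frieze M symmetric zero⇒diag diag⇒zero diamond ⟩
    ((- negTwoPow s) * M zero (fromℕ (suc s))) * prodFin (suc s) (λ i → M (inject₁ i) (suc i))
      ≈⟨ friezeDetRHS-suc s M ⟨
    friezeDetRHS (suc s) M ∎
  where
  open FractionFieldFrieze R nt nzd ch
  open CommutativeRing F-commutativeRing hiding (zero)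
  open IsFriezeMatrix isFrieze
  open import Relation.Binary.Reasoning.Setoid setoid
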